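{- Let $f\in\mathbb Z[X]$ be a quadratic polynomial whose coefficients have greatest common divisor $1$. Then $\delta(f)<1$, where $$\delta(f)=\prod_{q>2}\left(1-\frac{\#\{s\bmod q: f(s)\equiv 1\pmod q\}}{q\,\#\{s\bmod q: f(s)\not\equiv 0\pmod q\}}\right),$$ the product running over odd primes $q$. -}

module Defs where

open import Data.Bool using (Bool; true; false; if_then_else_; _∧_; not)
open import Data.Nat as ℕ using (ℕ; zero; suc; _<?_)
open import Data.Nat.Divisibility using (_∣?_)
open import Data.Nat.Primality using (prime?)
open import Data.Integer as ℤ using (ℤ; +_; ∣_∣)
open import Data.Rational as ℚ using (ℚ; 0ℚ; 1ℚ)
open import Relation.Nullary using (does)

evalQ : ℤ → ℤ → ℤ → ℤ → ℤ
evalQ a b c s = a ℤ.* (s ℤ.* s) ℤ.+ b ℤ.* s ℤ.+ c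

divB : ℕ → ℤ → Bool
divB q x = does (q ∣? ∣ x ∣)

countBelow : (ℕ → Bool) → ℕ → ℕ
countBelow p zero = 0
countBelow p (suc n) = if p n then suc (countBelow p n) else countBelow p n

numOne : ℤ → ℤ → ℤ → ℕ → ℕ
numOne a b c q = countBelow (λ s → divB q (evalQ a b c (+ s) ℤ.- ℤ.1ℤ)) q

numNonzero : ℤ → ℤ → ℤ → ℕ → ℕ
numNonzero a b c q = countBelow (λ s → not (divB q (evalQ a b c (+ s)))) q

-- n / d as a rational; the case d = 0 never occurs for the odd primes used below
-- (a quadratic with coprime coefficients cannot vanish identically mod an odd prime).
fracℚ : ℕ → ℕ → ℚ
fracℚ n zero = 0ℚ
fracℚ n (suc d) = (+ n) ℚ./ suc d

localFactor : ℤ → ℤ → ℤ → ℕ → ℚ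
localFactor a b c q = 1ℚ ℚ.- fracℚ (numOne a b c q) (q ℕ.* numNonzero a b c q)

oddPrimeB : ℕ → Bool
oddPrimeB q = does (prime? q) ∧ does (2 <? q)

partialδ : ℤ → ℤ → ℤ → ℕ → ℚ
partialδ a b c zero = 1ℚ
partialδ a b c (suc m) =
  if oddPrimeB (suc m) then partialδ a b c m ℚ.* localFactor a b c (suc m)
  else partialδ a b c m

-- The partial products are products of factors in [0, 1], so it suffices to find one odd
-- prime q and one s with f(s) ≡ 1 (mod q): then f(s) ≢ 0 (mod q) too, and the factor at q
-- is at most 1 - 1/q². If c = 1, then f(0) = 1 and any q works. Otherwise, with d = c - 1,
-- f(±2d) - 1 = d (1 + 2(2ad ± b)); the two odd cofactors add up to 8ad + 2 with ad ≠ 0, so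
-- one of them is not ±1, and any prime divisor of it is an odd q as required.
module Submission where

open import Defs
open import Data.Bool using (true; false; not; _∧_)
open import Data.Nat as ℕ using (ℕ; zero; suc; z≤n; s≤s; _≤′_; ≤′-refl; ≤′-step)
import Data.Nat.Properties as ℕP
open import Data.Nat.Divisibility as ℕD using (_∣?_)
open import Data.Nat.GCD using (gcd)
open import Data.Nat.Primality using (Prime; prime?)
open import Data.Integer as ℤ using (ℤ; +_; 0ℤ; 1ℤ; ∣_∣)
import Data.Integer.Properties as ℤP
import Data.Integer.Divisibility.Signed as ℤD
open import Data.Product using (∃-syntax; _×_; _,_)
open import Data.Sum using (_⊎_; inj₁; inj₂)
open import Relation.Nullary using (yes; no; ¬_)
open import Relation.Nullary.Decidable using (dec-true; dec-false; from-yes; from-no)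
open import Relation.Nullary.Negation using (contradiction)
open import Relation.Binary.PropositionalEquality
import Data.Nat

module QuadraticValues where
  open import Data.Nat.Induction using (<-rec)
  open import Data.Nat.Primality using (¬prime⇒composite; composite; prime⇒nonZero; prime⇒nonTrivial)
  open import Data.Integer.DivMod using (_%ℕ_; _/ℕ_; a≡a%ℕn+[a/ℕn]*n; n%ℕd<d)
  open import Data.Integer.Tactic.RingSolver using (solve-∀)
  open import Data.Integer using (-_; _+_; _*_; _-_)

  prime-divisor : ∀ n → 2 ℕ.≤ n → ∃[ p ] (Prime p × p ℕD.∣ n)
  prime-divisor = <-rec _ step
    where
    step : ∀ n → (∀ {m} → m ℕ.< n → 2 ℕ.≤ m → ∃[ p ] (Prime p × p ℕD.∣ m)) →
           2 ℕ.≤ n → ∃[ p ] (Prime p × p ℕD.∣ n)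
    step n rec 2≤n with prime? n
    ... | yes n-prime = n , n-prime , ℕD.∣-refl
    ... | no ¬n-prime with ¬prime⇒composite {{ℕ.n>1⇒nonTrivial 2≤n}} ¬n-prime
    ... | composite {d} d<n d∣n with rec d<n (ℕ.nonTrivial⇒n>1 d)
    ... | p , p-prime , p∣d = p , p-prime , ℕD.∣-trans p∣d d∣n

  odd-prime-divisor : ∀ v → 2 ℕ.≤ ∣ 1ℤ + + 2 * v ∣ →
    ∃[ p ] (Prime p × 2 ℕ.< p × + p ℤD.∣ 1ℤ + + 2 * v)
  odd-prime-divisor v 2≤∣u∣ with prime-divisor _ 2≤∣u∣
  ... | p , p-prime , p∣u =
    p , p-prime , ℕP.≤∧≢⇒< (ℕ.nonTrivial⇒n>1 p {{prime⇒nonTrivial p-prime}}) 2≢p , ℤD.∣ᵤ⇒∣ p∣u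
    where
    2≢p : 2 ≢ p
    2≢p refl with ℕD.∣1⇒≡1 (ℤD.∣⇒∣ᵤ (ℤD.∣m+n∣n⇒∣m {+ 2} {1ℤ} (ℤD.∣ᵤ⇒∣ p∣u) (ℤD.∣m⇒∣m*n v ℤD.∣-refl)))
    ... | ()

  sub∣evalQ-sub : ∀ a b c s t → (s - t) ℤD.∣ (evalQ a b c s - evalQ a b c t)
  sub∣evalQ-sub a b c s t = ℤD.divides (a * (s + t) + b) (ring a b c s t)
    where
    -- solve-∀ does not unfold evalQ, so identities about it are stated unfolded.
    ring : ∀ a b c s t →
      (a * (s * s) + b * s + c) - (a * (t * t) + b * t + c) ≡ (a * (s + t) + b) * (s - t)
    ring = solve-∀

  evalQ≡1-mod-residue : ∀ a b c q .{{_ : ℕ.NonZero q}} t → + q ℤD.∣ evalQ a b c t - 1ℤ →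
    ∃[ r ] (r ℕ.< q × + q ℤD.∣ evalQ a b c (+ r) - 1ℤ)
  evalQ≡1-mod-residue a b c q t q∣ft-1 = t %ℕ q , n%ℕd<d t q ,
    subst (+ q ℤD.∣_) (telescope (evalQ a b c s) (evalQ a b c t))
      (ℤD.∣m∣n⇒∣m+n (ℤD.∣-trans q∣s-t (sub∣evalQ-sub a b c s t)) q∣ft-1)
    where
    s = + (t %ℕ q)
    k = t /ℕ q
    reduce : ∀ s k q → s - (s + k * q) ≡ - k * q
    reduce = solve-∀
    q∣s-t : + q ℤD.∣ s - t
    q∣s-t = ℤD.divides (- k) (trans (cong (λ u → s - u) (a≡a%ℕn+[a/ℕn]*n t q)) (reduce s k (+ q)))
    telescope : ∀ x y → (x - y) + (y - 1ℤ) ≡ x - 1ℤ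
    telescope = solve-∀

  large-summand : ∀ k u v .{{_ : ℤ.NonZero k}} → u + v - + 2 ≡ + 8 * k →
    2 ℕ.≤ ∣ u ∣ ⊎ 2 ℕ.≤ ∣ v ∣
  large-summand k u v sum with 2 ℕ.≤? ∣ u ∣ | 2 ℕ.≤? ∣ v ∣
  ... | yes 2≤∣u∣ | _        = inj₁ 2≤∣u∣
  ... | no _      | yes 2≤∣v∣ = inj₂ 2≤∣v∣
  ... | no ∣u∣≱2   | no ∣v∣≱2   = contradiction (ℕP.≤-trans 8≤∣8k∣ ∣8k∣≤4) (from-no (8 ℕ.≤? 4))
    where
    open ℕP.≤-Reasoning
    8≤∣8k∣ : 8 ℕ.≤ ∣ + 8 * k ∣
    8≤∣8k∣ = begin
      8            ≤⟨ ℕP.*-monoʳ-≤ 8 (ℕ.>-nonZero⁻¹ ∣ k ∣) ⟩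
      8 ℕ.* ∣ k ∣  ≡⟨ ℤP.∣i*j∣≡∣i∣*∣j∣ (+ 8) k ⟨
      ∣ + 8 * k ∣  ∎
    ∣8k∣≤4 : ∣ + 8 * k ∣ ℕ.≤ 4
    ∣8k∣≤4 = begin
      ∣ + 8 * k ∣            ≡⟨ cong ∣_∣ sum ⟨
      ∣ u + v - + 2 ∣        ≤⟨ ℤP.∣i-j∣≤∣i∣+∣j∣ (u + v) (+ 2) ⟩
      ∣ u + v ∣ ℕ.+ 2        ≤⟨ ℕP.+-monoˡ-≤ 2 (ℤP.∣i+j∣≤∣i∣+∣j∣ u v) ⟩
      ∣ u ∣ ℕ.+ ∣ v ∣ ℕ.+ 2  ≤⟨ ℕP.+-monoˡ-≤ 2 (ℕP.+-mono-≤ (≤1 ∣u∣≱2) (≤1 ∣v∣≱2)) ⟩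
      4                      ∎
      where
      ≤1 : ∀ {n} → ¬ 2 ℕ.≤ n → n ℕ.≤ 1
      ≤1 n≱2 = ℕP.≤-pred (ℕP.≰⇒> n≱2)

  odd-cofactor-large : ∀ k b .{{_ : ℤ.NonZero k}} →
    2 ℕ.≤ ∣ 1ℤ + + 2 * (+ 2 * k + b) ∣ ⊎ 2 ℕ.≤ ∣ 1ℤ + + 2 * (+ 2 * k - b) ∣
  odd-cofactor-large k b =
    large-summand k (1ℤ + + 2 * (+ 2 * k + b)) (1ℤ + + 2 * (+ 2 * k - b)) (ring k b)
    where
    ring : ∀ k b → (1ℤ + + 2 * (+ 2 * k + b)) + (1ℤ + + 2 * (+ 2 * k - b)) - + 2 ≡ + 8 * k
    ring = solve-∀

  evalQ-at-2[c-1] : ∀ a b c → evalQ a b c (+ 2 * (c - 1ℤ)) - 1ℤ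
                               ≡ (c - 1ℤ) * (1ℤ + + 2 * (+ 2 * (a * (c - 1ℤ)) + b))
  evalQ-at-2[c-1] = ring
    where
    ring : ∀ a b c → a * ((+ 2 * (c - 1ℤ)) * (+ 2 * (c - 1ℤ))) + b * (+ 2 * (c - 1ℤ)) + c - 1ℤ
                     ≡ (c - 1ℤ) * (1ℤ + + 2 * (+ 2 * (a * (c - 1ℤ)) + b))
    ring = solve-∀

  evalQ-at-neg-2[c-1] : ∀ a b c → evalQ a b c (- (+ 2 * (c - 1ℤ))) - 1ℤ
                                   ≡ (c - 1ℤ) * (1ℤ + + 2 * (+ 2 * (a * (c - 1ℤ)) - b))
  evalQ-at-neg-2[c-1] = ring
    where
    ring : ∀ a b c → a * (- (+ 2 * (c - 1ℤ)) * - (+ 2 * (c - 1ℤ))) + b * - (+ 2 * (c - 1ℤ)) + c - 1ℤ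
                     ≡ (c - 1ℤ) * (1ℤ + + 2 * (+ 2 * (a * (c - 1ℤ)) - b))
    ring = solve-∀

  evalQ-at-0 : ∀ a b c → evalQ a b c 0ℤ - 1ℤ ≡ c - 1ℤ
  evalQ-at-0 = ring
    where
    ring : ∀ a b c → a * (0ℤ * 0ℤ) + b * 0ℤ + c - 1ℤ ≡ c - 1ℤ
    ring = solve-∀

  evalQ-1-odd-multiple : ∀ a b c → a ≢ 0ℤ → c - 1ℤ ≢ 0ℤ →
    ∃[ t ] ∃[ v ] (evalQ a b c t - 1ℤ ≡ (c - 1ℤ) * (1ℤ + + 2 * v) × 2 ℕ.≤ ∣ 1ℤ + + 2 * v ∣)
  evalQ-1-odd-multiple a b c a≢0 c-1≢0
    with odd-cofactor-large (a * (c - 1ℤ)) b {{ℤP.i*j≢0 a _ {{ℤ.≢-nonZero a≢0}} {{ℤ.≢-nonZero c-1≢0}}}}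
  ... | inj₁ large = + 2 * (c - 1ℤ) , + 2 * (a * (c - 1ℤ)) + b , evalQ-at-2[c-1] a b c , large
  ... | inj₂ large = - (+ 2 * (c - 1ℤ)) , + 2 * (a * (c - 1ℤ)) - b , evalQ-at-neg-2[c-1] a b c , large

  evalQ≡1-mod-odd-prime : ∀ a b c → a ≢ 0ℤ →
    ∃[ q ] (Prime q × 2 ℕ.< q × ∃[ r ] (r ℕ.< q × + q ℤD.∣ evalQ a b c (+ r) - 1ℤ))
  evalQ≡1-mod-odd-prime a b c a≢0 with c - 1ℤ ℤP.≟ 0ℤ
  ... | yes c-1≡0 = 3 , from-yes (prime? 3) , ℕP.≤-refl , 0 , s≤s z≤n ,
    ℤD.divides 0ℤ (trans (evalQ-at-0 a b c) c-1≡0)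
  ... | no c-1≢0 with evalQ-1-odd-multiple a b c a≢0 c-1≢0
  ... | t , v , ft-1≡ , large with odd-prime-divisor v large
  ... | q , q-prime , 2<q , q∣ =
    q , q-prime , 2<q , evalQ≡1-mod-residue a b c q {{prime⇒nonZero q-prime}} t
      (subst (+ q ℤD.∣_) (sym ft-1≡) (ℤD.∣n⇒∣m*n (c - 1ℤ) q∣))

open QuadraticValues using (evalQ≡1-mod-odd-prime)

open import Data.Rational as ℚ using (0ℚ; 1ℚ; _<_; _≤_; _-_; _/_; _*_)
import Data.Rational.Properties as ℚP
import Data.Rational.Unnormalised as ℚᵘ
import Data.Rational.Unnormalised.Properties as ℚᵘP

countBelow≤n : ∀ p n → countBelow p n ℕ.≤ n
countBelow≤n p zero = z≤n
countBelow≤n p (suc n) with p n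
... | true  = s≤s (countBelow≤n p n)
... | false = ℕP.m≤n⇒m≤1+n (countBelow≤n p n)

countBelow>0 : ∀ p {n s} → s ℕ.< n → p s ≡ true → 0 ℕ.< countBelow p n
countBelow>0 p {suc n} {s} s<1+n ps with p n in pn | s ℕP.≟ n
... | true  | _        = s≤s z≤n
... | false | yes refl = contradiction (trans (sym ps) pn) λ ()
... | false | no s≢n   = countBelow>0 p (ℕP.≤∧≢⇒< (ℕP.≤-pred s<1+n) s≢n) ps

/-mono-≤ : ∀ i j m n .{{_ : ℕ.NonZero m}} .{{_ : ℕ.NonZero n}} →
  i ℤ.* + n ℤ.≤ j ℤ.* + m → i / m ≤ j / n
/-mono-≤ i j (suc m) (suc n) le = ℚP.toℚᵘ-cancel-≤
  (ℚᵘP.≤-respʳ-≃ (ℚᵘP.≃-sym (ℚP.toℚᵘ-fromℚᵘ (ℚᵘ.mkℚᵘ j n)))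
    (ℚᵘP.≤-respˡ-≃ (ℚᵘP.≃-sym (ℚP.toℚᵘ-fromℚᵘ (ℚᵘ.mkℚᵘ i m))) (ℚᵘ.*≤* le)))

+/-mono-≤ : ∀ i j m n .{{_ : ℕ.NonZero m}} .{{_ : ℕ.NonZero n}} →
  i ℕ.* n ℕ.≤ j ℕ.* m → + i / m ≤ + j / n
+/-mono-≤ i j m n le = /-mono-≤ (+ i) (+ j) m n
  (subst₂ ℤ._≤_ (ℤP.pos-* i n) (ℤP.pos-* j m) (ℤ.+≤+ le))

0≤fracℚ : ∀ n d → 0ℚ ≤ fracℚ n d
0≤fracℚ n zero    = ℚP.≤-refl
0≤fracℚ n (suc d) = +/-mono-≤ 0 n 1 (suc d) z≤n

fracℚ≤1 : ∀ n d → d ≡ 0 ⊎ n ℕ.≤ d → fracℚ n d ≤ 1ℚ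
fracℚ≤1 n zero    _          = +/-mono-≤ 0 1 1 1 z≤n
fracℚ≤1 n (suc d) (inj₂ n≤d) =
  +/-mono-≤ n 1 (suc d) 1 (subst₂ ℕ._≤_ (sym (ℕP.*-identityʳ n)) (sym (ℕP.*-identityˡ (suc d))) n≤d)

1/≤fracℚ : ∀ n d Q .{{_ : ℕ.NonZero Q}} → 1 ℕ.≤ n → 1 ℕ.≤ d → d ℕ.≤ Q → + 1 / Q ≤ fracℚ n d
1/≤fracℚ n (suc d) Q 1≤n _ d≤Q = +/-mono-≤ 1 n Q (suc d) (begin
  1 ℕ.* suc d  ≡⟨ ℕP.*-identityˡ (suc d) ⟩
  suc d        ≤⟨ d≤Q ⟩
  Q            ≡⟨ ℕP.*-identityˡ Q ⟨
  1 ℕ.* Q      ≤⟨ ℕP.*-monoˡ-≤ Q 1≤n ⟩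
  n ℕ.* Q      ∎)
  where open ℕP.≤-Reasoning

1-antimono-≤ : ∀ {p q} → p ≤ q → 1ℚ - q ≤ 1ℚ - p
1-antimono-≤ p≤q = ℚP.+-monoʳ-≤ 1ℚ (ℚP.neg-antimono-≤ p≤q)

p*q≤p : ∀ p q → 0ℚ ≤ p → q ≤ 1ℚ → p * q ≤ p
p*q≤p p q 0≤p q≤1 = begin
  p * q    ≤⟨ ℚP.*-monoˡ-≤-nonNeg p {{ℚ.nonNegative 0≤p}} q≤1 ⟩
  p * 1ℚ   ≡⟨ ℚP.*-identityʳ p ⟩
  p        ∎
  where open ℚP.≤-Reasoning

p*q≤q : ∀ p q → p ≤ 1ℚ → 0ℚ ≤ q → p * q ≤ q
p*q≤q p q p≤1 0≤q = begin
  p * q    ≤⟨ ℚP.*-monoʳ-≤-nonNeg q {{ℚ.nonNegative 0≤q}} p≤1 ⟩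
  1ℚ * q   ≡⟨ ℚP.*-identityˡ q ⟩
  q        ∎
  where open ℚP.≤-Reasoning

0≤p*q : ∀ p q → 0ℚ ≤ p → 0ℚ ≤ q → 0ℚ ≤ p * q
0≤p*q p q 0≤p 0≤q = ℚP.nonNegative⁻¹ (p * q)
  {{ℚP.nonNeg*nonNeg⇒nonNeg p {{ℚ.nonNegative 0≤p}} q {{ℚ.nonNegative 0≤q}}}}

numOne≤q*numNonzero : ∀ a b c q →
  q ℕ.* numNonzero a b c q ≡ 0 ⊎ numOne a b c q ℕ.≤ q ℕ.* numNonzero a b c q
numOne≤q*numNonzero a b c q with numNonzero a b c q
... | zero  = inj₁ (ℕP.*-zeroʳ q)
... | suc n = inj₂ (ℕP.≤-trans (countBelow≤n _ q) (ℕP.m≤m*n q (suc n)))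

localFactor≤1 : ∀ a b c q → localFactor a b c q ≤ 1ℚ
localFactor≤1 a b c q = 1-antimono-≤ (0≤fracℚ (numOne a b c q) (q ℕ.* numNonzero a b c q))

0≤localFactor : ∀ a b c q → 0ℚ ≤ localFactor a b c q
0≤localFactor a b c q = 1-antimono-≤ (fracℚ≤1 _ _ (numOne≤q*numNonzero a b c q))

0≤partialδ : ∀ a b c m → 0ℚ ≤ partialδ a b c m
0≤partialδ a b c zero = ℚ.*≤* (ℤ.+≤+ z≤n)
0≤partialδ a b c (suc m) with oddPrimeB (suc m)
... | true  = 0≤p*q _ _ (0≤partialδ a b c m) (0≤localFactor a b c (suc m))
... | false = 0≤partialδ a b c m

partialδ-suc≤ : ∀ a b c m → partialδ a b c (suc m) ≤ partialδ a b c m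
partialδ-suc≤ a b c m with oddPrimeB (suc m)
... | true  = p*q≤p _ _ (0≤partialδ a b c m) (localFactor≤1 a b c (suc m))
... | false = ℚP.≤-refl

partialδ-antitone : ∀ a b c {m n} → m ℕ.≤ n → partialδ a b c n ≤ partialδ a b c m
partialδ-antitone a b c {m} m≤n = go (ℕP.≤⇒≤′ m≤n)
  where
  go : ∀ {n} → m ≤′ n → partialδ a b c n ≤ partialδ a b c m
  go ≤′-refl          = ℚP.≤-refl
  go (≤′-step {n} m≤n) = ℚP.≤-trans (partialδ-suc≤ a b c n) (go m≤n)

partialδ≤localFactor : ∀ a b c q → oddPrimeB q ≡ true → partialδ a b c q ≤ localFactor a b c q
partialδ≤localFactor a b c (suc m) q-odd-prime rewrite q-odd-prime =
  p*q≤q _ _ (partialδ-antitone a b c {0} {m} z≤n) (0≤localFactor a b c (suc m))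

localFactor≤1-1/q² : ∀ a b c q r .{{_ : ℕ.NonZero (q ℕ.* q)}} → 1 ℕ.< q → r ℕ.< q →
  + q ℤD.∣ evalQ a b c (+ r) ℤ.- 1ℤ → localFactor a b c q ≤ 1ℚ - + 1 / (q ℕ.* q)
localFactor≤1-1/q² a b c q r 1<q r<q q∣fr-1 = 1-antimono-≤
  (1/≤fracℚ _ _ (q ℕ.* q) 1≤numOne (ℕP.*-mono-≤ (ℕP.<⇒≤ 1<q) 1≤numNonzero)
    (ℕP.*-monoʳ-≤ q (countBelow≤n _ q)))
  where
  q∤fr : ¬ q ℕD.∣ ∣ evalQ a b c (+ r) ∣
  q∤fr q∣fr = ℕP.<⇒≢ 1<q (sym (ℕD.∣1⇒≡1 (ℤD.∣⇒∣ᵤ (ℤD.∣m+n∣m⇒∣n {+ q} {evalQ a b c (+ r)} {ℤ.- 1ℤ} q∣fr-1 (ℤD.∣ᵤ⇒∣ q∣fr)))))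
  1≤numOne : 1 ℕ.≤ numOne a b c q
  1≤numOne = countBelow>0 _ r<q (dec-true (q ∣? _) (ℤD.∣⇒∣ᵤ q∣fr-1))
  1≤numNonzero : 1 ℕ.≤ numNonzero a b c q
  1≤numNonzero = countBelow>0 _ r<q (cong not (dec-false (q ∣? _) q∤fr))

oddPrimeB-complete : ∀ q → Prime q → 2 ℕ.< q → oddPrimeB q ≡ true
oddPrimeB-complete q q-prime 2<q = cong₂ _∧_ (dec-true (prime? q) q-prime) (dec-true (2 ℕ.<? q) 2<q)

proposition4 : (a b c : ℤ) → a ≢ 0ℤ → gcd (gcd ∣ a ∣ ∣ b ∣) ∣ c ∣ ≡ 1 →
    ∃[ ε ] (0ℚ < ε × ∃[ N ] ((M : ℕ) → N Data.Nat.≤ M → partialδ a b c M ≤ 1ℚ - ε))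
-- Coprimality of the coefficients is not needed: fracℚ is 0 on a zero denominator, so every
-- local factor lies in [0, 1] regardless.
proposition4 a b c a≢0 _ with evalQ≡1-mod-odd-prime a b c a≢0
... | zero , _ , () , _
... | q@(suc _) , q-prime , 2<q , r , r<q , q∣fr-1 =
  ε , ℚP.positive⁻¹ ε {{ℚP.normalize-pos 1 (q ℕ.* q)}} , q , bound
  where
  ε = + 1 / (q ℕ.* q)
  bound : ∀ M → q ℕ.≤ M → partialδ a b c M ≤ 1ℚ - ε
  bound M q≤M = begin
    partialδ a b c M      ≤⟨ partialδ-antitone a b c q≤M ⟩
    partialδ a b c q      ≤⟨ partialδ≤localFactor a b c q (oddPrimeB-complete q q-prime 2<q) ⟩
    localFactor a b c q   ≤⟨ localFactor≤1-1/q² a b c q r (ℕP.<-trans (s≤s (s≤s z≤n)) 2<q) r<q q∣fr-1 ⟩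
    1ℚ - ε                ∎
    where open ℚP.≤-Reasoning
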